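{- For every set $\mathcal{E}\subseteq\Lambda_s$ of simple terms, the following are equivalent: (1) $\mathcal{E}$ is a maximal clique having finite height; (2) there exists a $\lambda$-term $M\in\Lambda$ such that $\mathcal{E} = \mathcal{T}(M)$.
   Context: Setting: call-by-value resource calculus. $\lambda$-terms are $M,N ::= V \mid MN$ with values $V ::= x \mid \lambda x.M$ ($\Lambda$ denotes the set of $\lambda$-terms). Resource values $u,v ::= x \mid \lambda x.t$; simple terms $s,t ::= st \mid [v_1,\dots,v_k]$ ($k\ge 0$, bags are finite multisets); resource terms $e ::= v \mid s$. $\Lambda_s$ is the set of simple terms. Height: $h(x)=0$, $h(\lambda x.t)=h(t)+1$, $h(st)=\max\{h(s),h(t)\}+1$, $h([v_1,\dots,v_k])=\max\{h(v_i)\}+1$; the height of a non-empty set of resource terms is the maximum height of its elements if it exists (finite height), and infinite otherwise. Taylor expansion: $\mathcal{T}(x)=\{[x,\dots,x]\ (n\text{ times}) \mid n\ge 0\}$, $\mathcal{T}(\lambda x.N)=\{[\lambda x.t_1,\dots,\lambda x.t_n]\mid n\ge 0,\ t_i\in\mathcal{T}(N)\}$, $\mathcal{T}(PQ)=\{st\mid s\in\mathcal{T}(P),t\in\mathcal{T}(Q)\}$. Coherence is the smallest binary relation $\frown$ on resource terms such that: $x\frown x$; $\lambda x.s\frown\lambda x.t$ if $s\frown t$; $[v_1,\dots,v_k]\frown[v_{k+1},\dots,v_n]$ if $v_i\frown v_j$ for all $i,j\le n$; $s_1t_1\frown s_2t_2$ if $s_1\frown s_2$ and $t_1\frown t_2$.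 A set $\mathcal{E}$ of resource terms is a clique if $e\frown e'$ for all $e,e'\in\mathcal{E}$, and a maximal clique if moreover, for every resource term $e$, $\mathcal{E}\cup\{e\}$ being a clique implies $e\in\mathcal{E}$. -}

module Defs where

open import Level using (0ℓ)
open import Data.Nat using (ℕ; zero; suc; _⊔_; _≤_)
open import Data.List using (List; []; _∷_; _++_; replicate; map)
open import Data.List.Relation.Unary.All using (All)
open import Data.List.Membership.Propositional using (_∈_)
open import Data.Product using (Σ; ∃; _×_)
open import Data.Sum using (_⊎_; inj₁; inj₂)
open import Data.Empty using (⊥)
open import Relation.Binary.PropositionalEquality using (_≡_)

Var : Set
Var = ℕ

data Λ : Set where
  var : Var → Λ
  lam : Var → Λ → Λ
  app : Λ → Λ → Λ

-- Resource values and simple terms (bags are finite multisets, represented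
-- by lists; every notion below is invariant under permutation of bags).
mutual
  data RValue : Set where
    rvar : Var → RValue
    rlam : Var → STerm → RValue

  data STerm : Set where
    sapp : STerm → STerm → STerm
    bag  : List RValue → STerm

RTerm : Set
RTerm = RValue ⊎ STerm

mutual
  hv : RValue → ℕ
  hv (rvar x)   = 0
  hv (rlam x t) = suc (hs t)

  hs : STerm → ℕ
  hs (sapp s t) = suc (hs s ⊔ hs t)
  hs (bag vs)   = suc (hl vs)

  hl : List RValue → ℕ
  hl []       = 0
  hl (v ∷ vs) = hv v ⊔ hl vs

mutual
  data _⌢v_ : RValue → RValue → Set where
    var⌢ : ∀ {x} → rvar x ⌢v rvar x
    lam⌢ : ∀ {x s t} → s ⌢s t → rlam x s ⌢v rlam x t

  data _⌢s_ : STerm → STerm → Set where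
    bag⌢ : ∀ {us vs} →
           (∀ u v → u ∈ (us ++ vs) → v ∈ (us ++ vs) → u ⌢v v) →
           bag us ⌢s bag vs
    app⌢ : ∀ {s₁ s₂ t₁ t₂} → s₁ ⌢s s₂ → t₁ ⌢s t₂ → sapp s₁ t₁ ⌢s sapp s₂ t₂

data _⌢_ : RTerm → RTerm → Set where
  val⌢ : ∀ {u v} → u ⌢v v → inj₁ u ⌢ inj₁ v
  sim⌢ : ∀ {s t} → s ⌢s t → inj₂ s ⌢ inj₂ t

RSet : Set₁
RSet = RTerm → Set

SSet : Set₁
SSet = STerm → Set

embed : SSet → RSet
embed E (inj₁ v) = ⊥
embed E (inj₂ s) = E s

_∪⟨_⟩ : RSet → RTerm → RSet
(E ∪⟨ e ⟩) e' = E e' ⊎ e' ≡ e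

IsClique : RSet → Set
IsClique E = ∀ e e' → E e → E e' → e ⌢ e'

IsMaximalClique : RSet → Set
IsMaximalClique E = IsClique E × (∀ e → IsClique (E ∪⟨ e ⟩) → E e)

HasFiniteHeight : SSet → Set
HasFiniteHeight E =
  Σ ℕ λ n → (Σ STerm λ e → E e × hs e ≡ n) × (∀ e → E e → hs e ≤ n)

T : Λ → SSet
T (var x)   s = Σ ℕ λ n → s ≡ bag (replicate n (rvar x))
T (lam x N) s = Σ (List STerm) λ ts → All (T N) ts × s ≡ bag (map (rlam x) ts)
T (app P Q) s = Σ STerm λ s₁ → Σ STerm λ t₁ → s ≡ sapp s₁ t₁ × T P s₁ × T Q t₁

_≐_ : SSet → SSet → Set
E ≐ F = ∀ s → (E s → F s) × (F s → E s)

-- A Taylor expansion T M is a clique of finite height, and it is saturated: any simple term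
-- coherent with all of T M already lies in it, since coherence with the "smallest" elements
-- ([] for variables and abstractions, a single application for applications) fixes its shape,
-- and coherence with the one-element bags fixes its components. Conversely, let E be a maximal
-- clique of height at most n+1. All elements of E share the shape of one of them. If they are
-- applications, the left and the right components form maximal cliques of height at most n and
-- E is their product. If they are bags, the values occurring in them form a value clique, which
-- is non-empty (otherwise [x] could be added to E) and hence consists either of copies of one
-- variable x, giving E = T x, or of abstractions λx.t whose bodies form a maximal clique of
-- height at most n, giving E = T (λx.N).
module Submission where

open import Defs
open import Level using (0ℓ)
open import Axiom.ExcludedMiddle using (ExcludedMiddle)
open import Function.Bundles using (_⇔_; mk⇔)
open import Data.Nat using (ℕ; zero; suc; _⊔_; _≤_; z≤n; s≤s; s≤s⁻¹)
open import Data.Nat.Properties using (≤-trans; ⊔-lub; ⊔-mono-≤; n≤1+n; m≤m⊔n; m≤n⊔m)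
open import Data.Product using (Σ; _×_; _,_; proj₁; proj₂)
open import Data.Sum using (_⊎_; inj₁; inj₂)
open import Data.Empty using (⊥-elim)
open import Data.List using (List; []; _∷_; replicate; map; length)
open import Data.List.Relation.Unary.All as All using (All; []; _∷_)
open import Data.List.Relation.Unary.All.Properties using (++⁺; map⁺; replicate⁺)
open import Data.List.Relation.Unary.Any using (here; there)
open import Data.List.Relation.Unary.Any.Properties using (++-comm)
open import Data.List.Membership.Propositional using (_∈_)
open import Data.List.Membership.Propositional.Properties using (∈-++⁺ˡ; ∈-++⁺ʳ)
open import Relation.Nullary using (¬_; yes; no)
open import Relation.Binary.PropositionalEquality using (_≡_; refl; cong; cong₂)

⌢s-sym : ∀ {s t} → s ⌢s t → t ⌢s s
⌢s-sym (bag⌢ {us} {vs} coh) =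
  bag⌢ λ u v u∈ v∈ → coh u v (++-comm vs us u∈) (++-comm vs us v∈)
⌢s-sym (app⌢ p q) = app⌢ (⌢s-sym p) (⌢s-sym q)

bag⌢-inv : ∀ {us vs u v} → bag us ⌢s bag vs → u ∈ us → v ∈ vs → u ⌢v v
bag⌢-inv {us} (bag⌢ coh) u∈ v∈ = coh _ _ (∈-++⁺ˡ u∈) (∈-++⁺ʳ us v∈)

lam⌢-inv : ∀ {x s t} → rlam x s ⌢v rlam x t → s ⌢s t
lam⌢-inv (lam⌢ p) = p

app⌢-invˡ : ∀ {a b c d} → sapp a b ⌢s sapp c d → a ⌢s c
app⌢-invˡ (app⌢ p _) = p

app⌢-invʳ : ∀ {a b c d} → sapp a b ⌢s sapp c d → b ⌢s d
app⌢-invʳ (app⌢ _ q) = q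

bag⌢-shape : ∀ {vs t} → bag vs ⌢s t → Σ (List RValue) λ ws → t ≡ bag ws
bag⌢-shape (bag⌢ {vs = ws} _) = ws , refl

app⌢-shape : ∀ {a b t} → sapp a b ⌢s t → Σ STerm λ c → Σ STerm λ d → t ≡ sapp c d
app⌢-shape (app⌢ {s₂ = c} {t₂ = d} _ _) = c , d , refl

⌢v-rvar : ∀ {u x} → u ⌢v rvar x → u ≡ rvar x
⌢v-rvar var⌢ = refl

⌢v-rlam : ∀ {u x t} → u ⌢v rlam x t → Σ STerm λ s → u ≡ rlam x s
⌢v-rlam (lam⌢ {s = s} _) = s , refl

SimpleClique : SSet → Set
SimpleClique F = ∀ {s t} → F s → F t → s ⌢s t

ValueClique : (RValue → Set) → Set
ValueClique W = ∀ {u v} → W u → W v → u ⌢v v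

Saturated : SSet → Set
Saturated F = ∀ s → s ⌢s s → (∀ {t} → F t → s ⌢s t) → F s

insert-clique : ∀ {F s} → SimpleClique F → s ⌢s s → (∀ {t} → F t → s ⌢s t) →
                SimpleClique (λ t → F t ⊎ t ≡ s)
insert-clique cl s⌢s s⌢F (inj₁ p) (inj₁ q)       = cl p q
insert-clique cl s⌢s s⌢F (inj₁ p) (inj₂ refl)    = ⌢s-sym (s⌢F p)
insert-clique cl s⌢s s⌢F (inj₂ refl) (inj₁ q)    = s⌢F q
insert-clique cl s⌢s s⌢F (inj₂ refl) (inj₂ refl) = s⌢s

bag-coherent : ∀ {W us vs} → ValueClique W → All W us → All W vs → bag us ⌢s bag vs
bag-coherent cl Wus Wvs = bag⌢ λ u v u∈ v∈ → cl (All.lookup W++ u∈) (All.lookup W++ v∈)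
  where W++ = ++⁺ Wus Wvs

rvar-clique : ∀ x → ValueClique (_≡ rvar x)
rvar-clique x refl refl = var⌢

All-≡⇒replicate : ∀ {c : RValue} {ws} → All (_≡ c) ws → ws ≡ replicate (length ws) c
All-≡⇒replicate []           = refl
All-≡⇒replicate (refl ∷ eqs) = cong (_ ∷_) (All-≡⇒replicate eqs)

data LamOf (x : Var) (G : SSet) : RValue → Set where
  rlam∈ : ∀ {t} → G t → LamOf x G (rlam x t)

LamOf-clique : ∀ {x G} → SimpleClique G → ValueClique (LamOf x G)
LamOf-clique cl (rlam∈ g) (rlam∈ g′) = lam⌢ (cl g g′)

All-LamOf-map : ∀ {x G ts} → All G ts → All (LamOf x G) (map (rlam x) ts)
All-LamOf-map Gts = map⁺ (All.map rlam∈ Gts)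

All-LamOf⇒map : ∀ {x G ws} → All (LamOf x G) ws →
                Σ (List STerm) λ ts → All G ts × ws ≡ map (rlam x) ts
All-LamOf⇒map []             = [] , [] , refl
All-LamOf⇒map (rlam∈ g ∷ ls) with All-LamOf⇒map ls
... | ts , Gts , refl = _ ∷ ts , g ∷ Gts , refl

maximalClique⇒simpleClique : ∀ {F} → IsMaximalClique (embed F) → SimpleClique F
maximalClique⇒simpleClique (cl , _) {s} {t} p q with cl (inj₂ s) (inj₂ t) p q
... | sim⌢ s⌢t = s⌢t

maximalClique⇒saturated : ∀ {F} → IsMaximalClique (embed F) → Saturated F
maximalClique⇒saturated {F} max@(_ , maximal) s s⌢s s⌢F = maximal (inj₂ s) extended
  where
  extended : IsClique (embed F ∪⟨ inj₂ s ⟩)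
  extended (inj₂ a) (inj₂ b) p q =
    sim⌢ (insert-clique (maximalClique⇒simpleClique max) s⌢s s⌢F (lift p) (lift q))
    where
    lift : ∀ {c} → (embed F ∪⟨ inj₂ s ⟩) (inj₂ c) → F c ⊎ c ≡ s
    lift (inj₁ r)    = inj₁ r
    lift (inj₂ refl) = inj₂ refl
  extended (inj₁ _) _ (inj₁ ()) _
  extended (inj₁ _) _ (inj₂ ()) _
  extended (inj₂ _) (inj₁ _) _ (inj₁ ())
  extended (inj₂ _) (inj₁ _) _ (inj₂ ())

saturatedClique⇒maximalClique : ∀ {F} → SimpleClique F → Saturated F → Σ STerm F →
                                IsMaximalClique (embed F)
saturatedClique⇒maximalClique {F} cl sat (s₀ , s₀∈) = clique , maximal
  where
  clique : IsClique (embed F)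
  clique (inj₂ a) (inj₂ b) p q = sim⌢ (cl p q)
  clique (inj₁ _) _ () _
  clique (inj₂ _) (inj₁ _) _ ()

  strip : ∀ {a b} → inj₂ a ⌢ inj₂ b → a ⌢s b
  strip (sim⌢ p) = p

  maximal : ∀ e → IsClique (embed F ∪⟨ e ⟩) → embed F e
  maximal (inj₁ v) K with K (inj₁ v) (inj₂ s₀) (inj₂ refl) (inj₁ s₀∈)
  ... | ()
  maximal (inj₂ s) K = sat s (strip (K _ _ (inj₂ refl) (inj₂ refl)))
                             (λ q → strip (K _ _ (inj₂ refl) (inj₁ q)))

maximalClique-resp-≐ : ∀ {E F} → E ≐ F → IsMaximalClique (embed F) → IsMaximalClique (embed E)
maximalClique-resp-≐ {E} {F} E≐F (cl , maximal) =
  (λ e e′ p q → cl e e′ (E⊆F e p) (E⊆F e′ q)) ,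
  (λ e K → F⊆E e (maximal e (λ e₁ e₂ p q → K e₁ e₂ (∪-map p) (∪-map q))))
  where
  E⊆F : ∀ e → embed E e → embed F e
  E⊆F (inj₂ s) = proj₁ (E≐F s)
  F⊆E : ∀ e → embed F e → embed E e
  F⊆E (inj₂ s) = proj₂ (E≐F s)
  ∪-map : ∀ {e e′} → (embed F ∪⟨ e ⟩) e′ → (embed E ∪⟨ e ⟩) e′
  ∪-map {e′ = e′} (inj₁ p) = inj₁ (F⊆E e′ p)
  ∪-map (inj₂ q) = inj₂ q

finiteHeight-resp-≐ : ∀ {E F} → E ≐ F → HasFiniteHeight F → HasFiniteHeight E
finiteHeight-resp-≐ E≐F (n , (s , s∈ , hs≡n) , bound) =
  n , (s , proj₂ (E≐F s) s∈ , hs≡n) , λ t t∈ → bound t (proj₁ (E≐F t) t∈)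

hv≤hl : ∀ {v ws} → v ∈ ws → hv v ≤ hl ws
hv≤hl {ws = w ∷ ws} (here refl) = m≤m⊔n (hv w) (hl ws)
hv≤hl {ws = w ∷ ws} (there v∈) = ≤-trans (hv≤hl v∈) (m≤n⊔m (hv w) (hl ws))

hs≰0 : ∀ s → ¬ hs s ≤ 0
hs≰0 (sapp _ _) ()
hs≰0 (bag _)    ()

T-nonempty : ∀ M → Σ STerm (T M)
T-nonempty (var x)   = bag [] , 0 , refl
T-nonempty (lam x N) = bag [] , [] , [] , refl
T-nonempty (app P Q) with T-nonempty P | T-nonempty Q
... | s , s∈ | t , t∈ = sapp s t , s , t , refl , s∈ , t∈

T-clique : ∀ M → SimpleClique (T M)
T-clique (var x) (n , refl) (m , refl) =
  bag-coherent (rvar-clique x) (replicate⁺ n refl) (replicate⁺ m refl)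
T-clique (lam x N) (_ , Tts , refl) (_ , Tts′ , refl) =
  bag-coherent (LamOf-clique (T-clique N)) (All-LamOf-map Tts) (All-LamOf-map Tts′)
T-clique (app P Q) (_ , _ , refl , p , q) (_ , _ , refl , p′ , q′) =
  app⌢ (T-clique P p p′) (T-clique Q q q′)

coherent-with-T⇒T : ∀ M s → (∀ {t} → T M t → s ⌢s t) → T M s
coherent-with-T⇒T (var x) s s⌢T with bag⌢-shape (⌢s-sym (s⌢T (0 , refl)))
... | ws , refl = length ws , cong bag (All-≡⇒replicate (All.tabulate λ w∈ →
        ⌢v-rvar (bag⌢-inv (s⌢T (1 , refl)) w∈ (here refl))))
coherent-with-T⇒T (lam x N) s s⌢T with bag⌢-shape (⌢s-sym (s⌢T ([] , [] , refl)))
... | ws , refl with All-LamOf⇒map (All.tabulate body∈)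
  where
  singleton∈ : ∀ {t} → T N t → T (lam x N) (bag (rlam x t ∷ []))
  singleton∈ t∈ = _ , t∈ ∷ [] , refl

  body∈ : ∀ {w} → w ∈ ws → LamOf x (T N) w
  body∈ w∈ with ⌢v-rlam (bag⌢-inv (s⌢T (singleton∈ (proj₂ (T-nonempty N)))) w∈ (here refl))
  ... | t , refl = rlam∈ (coherent-with-T⇒T N t λ t₁∈ →
        lam⌢-inv (bag⌢-inv (s⌢T (singleton∈ t₁∈)) w∈ (here refl)))
... | ts , Tts , eq = ts , Tts , cong bag eq
coherent-with-T⇒T (app P Q) s s⌢T with T-nonempty P | T-nonempty Q
... | s₀ , p₀ | t₀ , q₀ with app⌢-shape (⌢s-sym (s⌢T (s₀ , t₀ , refl , p₀ , q₀)))
... | c , d , refl =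
  c , d , refl ,
  coherent-with-T⇒T P c (λ p → app⌢-invˡ (s⌢T (_ , t₀ , refl , p , q₀))) ,
  coherent-with-T⇒T Q d (λ q → app⌢-invʳ (s⌢T (s₀ , _ , refl , p₀ , q)))

T-maximalClique : ∀ M → IsMaximalClique (embed (T M))
T-maximalClique M =
  saturatedClique⇒maximalClique (T-clique M) (λ s _ → coherent-with-T⇒T M s) (T-nonempty M)

height : Λ → ℕ
height (var x)   = 1
height (lam x N) = suc (suc (height N))
height (app P Q) = suc (height P ⊔ height Q)

T-height-bound : ∀ M s → T M s → hs s ≤ height M
T-height-bound (var x) _ (n , refl) = s≤s (hl-replicate n)
  where
  hl-replicate : ∀ n → hl (replicate n (rvar x)) ≤ 0
  hl-replicate zero    = z≤n
  hl-replicate (suc n) = hl-replicate n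
T-height-bound (lam x N) _ (ts , Tts , refl) = s≤s (hl-map Tts)
  where
  hl-map : ∀ {ts} → All (T N) ts → hl (map (rlam x) ts) ≤ suc (height N)
  hl-map []         = z≤n
  hl-map (t∈ ∷ Tts) = ⊔-lub (s≤s (T-height-bound N _ t∈)) (hl-map Tts)
T-height-bound (app P Q) _ (s , t , refl , p , q) =
  s≤s (⊔-mono-≤ (T-height-bound P s p) (T-height-bound Q t q))

T-height-attained : ∀ M → Σ STerm λ s → T M s × hs s ≡ height M
T-height-attained (var x) = bag [] , (0 , refl) , refl
T-height-attained (lam x N) with T-height-attained N
... | t , t∈ , eq = bag (rlam x t ∷ []) , (t ∷ [] , t∈ ∷ [] , refl) , cong (λ k → suc (suc k)) eq
T-height-attained (app P Q) with T-height-attained P | T-height-attained Q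
... | s , p , eq₁ | t , q , eq₂ =
  sapp s t , (s , t , refl , p , q) , cong₂ (λ a b → suc (a ⊔ b)) eq₁ eq₂

T-finiteHeight : ∀ M → HasFiniteHeight (T M)
T-finiteHeight M = height M , T-height-attained M , T-height-bound M

TaylorBelow : ℕ → Set₁
TaylorBelow n = ∀ {E} → SimpleClique E → Saturated E → Σ STerm E → (∀ s → E s → hs s ≤ n) →
                Σ Λ λ M → E ≐ T M

module Applications {E : SSet} (cl : SimpleClique E) (sat : Saturated E)
                    {a b : STerm} (ab∈ : E (sapp a b)) where

  shape : ∀ {s} → E s → Σ STerm λ c → Σ STerm λ d → s ≡ sapp c d
  shape s∈ = app⌢-shape (cl ab∈ s∈)

  Left : SSet
  Left c = Σ STerm λ d → E (sapp c d)

  Right : SSet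
  Right d = Σ STerm λ c → E (sapp c d)

  Left-clique : SimpleClique Left
  Left-clique (_ , p) (_ , q) = app⌢-invˡ (cl p q)

  Right-clique : SimpleClique Right
  Right-clique (_ , p) (_ , q) = app⌢-invʳ (cl p q)

  sapp∈ : ∀ {s t} → s ⌢s s → t ⌢s t → (∀ {c} → Left c → s ⌢s c) → (∀ {d} → Right d → t ⌢s d) →
          E (sapp s t)
  sapp∈ {s} {t} s⌢s t⌢t s⌢L t⌢R = sat (sapp s t) (app⌢ s⌢s t⌢t) coherent
    where
    coherent : ∀ {u} → E u → sapp s t ⌢s u
    coherent u∈ with shape u∈
    ... | c , d , refl = app⌢ (s⌢L (d , u∈)) (t⌢R (c , u∈))

  Left-saturated : Saturated Left
  Left-saturated s s⌢s s⌢L = b , sapp∈ s⌢s (Right-clique b∈ b∈) s⌢L (Right-clique b∈)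
    where b∈ = a , ab∈

  Right-saturated : Saturated Right
  Right-saturated t t⌢t t⌢R = a , sapp∈ (Left-clique a∈ a∈) t⌢t (Left-clique a∈) t⌢R
    where a∈ = b , ab∈

  Left-height : ∀ {n} → (∀ s → E s → hs s ≤ suc n) → ∀ c → Left c → hs c ≤ n
  Left-height bound c (d , p) = ≤-trans (m≤m⊔n (hs c) (hs d)) (s≤s⁻¹ (bound _ p))

  Right-height : ∀ {n} → (∀ s → E s → hs s ≤ suc n) → ∀ d → Right d → hs d ≤ n
  Right-height bound d (c , p) = ≤-trans (m≤n⊔m (hs c) (hs d)) (s≤s⁻¹ (bound _ p))

  ≐-app : ∀ {P Q} → Left ≐ T P → Right ≐ T Q → E ≐ T (app P Q)
  ≐-app {P} {Q} L≐P R≐Q s = to , from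
    where
    to : E s → T (app P Q) s
    to s∈ with shape s∈
    ... | c , d , refl = c , d , refl , proj₁ (L≐P c) (d , s∈) , proj₁ (R≐Q d) (c , s∈)
    from : T (app P Q) s → E s
    from (c , d , refl , p , q) =
      sapp∈ (Left-clique c∈ c∈) (Right-clique d∈ d∈) (Left-clique c∈) (Right-clique d∈)
      where
      c∈ = proj₂ (L≐P c) p
      d∈ = proj₂ (R≐Q d) q

  app-case : ∀ {n} → TaylorBelow n → (∀ s → E s → hs s ≤ suc n) → Σ Λ λ M → E ≐ T M
  app-case IH bound
    with IH Left-clique Left-saturated (a , b , ab∈) (Left-height bound)
       | IH Right-clique Right-saturated (b , a , ab∈) (Right-height bound)
  ... | P , L≐P | Q , R≐Q = app P Q , ≐-app L≐P R≐Q

module Bags {E : SSet} (cl : SimpleClique E) (sat : Saturated E)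
            {vs : List RValue} (vs∈ : E (bag vs)) where

  shape : ∀ {s} → E s → Σ (List RValue) λ ws → s ≡ bag ws
  shape s∈ = bag⌢-shape (cl vs∈ s∈)

  Values : RValue → Set
  Values v = Σ (List RValue) λ ws → E (bag ws) × v ∈ ws

  Values-clique : ValueClique Values
  Values-clique (_ , p , u∈) (_ , q , v∈) = bag⌢-inv (cl p q) u∈ v∈

  values : ∀ {ws} → E (bag ws) → All Values ws
  values p = All.tabulate λ v∈ → _ , p , v∈

  bag∈ : ∀ {W ws} → ValueClique W → (∀ {v} → Values v → W v) → All W ws → E (bag ws)
  bag∈ {W} {ws} Wcl V⊆W Wws = sat (bag ws) (bag-coherent Wcl Wws Wws) coherent
    where
    coherent : ∀ {t} → E t → bag ws ⌢s t
    coherent t∈ with shape t∈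
    ... | ws′ , refl = bag-coherent Wcl Wws (All.map V⊆W (values t∈))

  Values-nonempty : ¬ (¬ Σ RValue Values)
  Values-nonempty none = none (rvar 0 , _ , x∈ , here refl)
    where
    V⊆x : ∀ {v} → Values v → v ≡ rvar 0
    V⊆x v∈ = ⊥-elim (none (_ , v∈))
    x∈ : E (bag (rvar 0 ∷ []))
    x∈ = bag∈ (rvar-clique 0) V⊆x (refl ∷ [])

  ≐-var : ∀ {x} → Values (rvar x) → E ≐ T (var x)
  ≐-var {x} x∈ s = to , from
    where
    V⊆x : ∀ {v} → Values v → v ≡ rvar x
    V⊆x v∈ = ⌢v-rvar (Values-clique v∈ x∈)
    to : E s → T (var x) s
    to s∈ with shape s∈
    ... | ws , refl = length ws , cong bag (All-≡⇒replicate (All.map V⊆x (values s∈)))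
    from : T (var x) s → E s
    from (n , refl) = bag∈ (rvar-clique x) V⊆x (replicate⁺ n refl)

  module Abstractions {x : Var} {t₀ : STerm} (λt₀∈ : Values (rlam x t₀)) where

    Body : SSet
    Body t = Values (rlam x t)

    Body-nonempty : Σ STerm Body
    Body-nonempty = t₀ , λt₀∈

    Body-clique : SimpleClique Body
    Body-clique p q = lam⌢-inv (Values-clique p q)

    V⊆LamOf : ∀ {G} → (∀ {t} → Body t → G t) → ∀ {v} → Values v → LamOf x G v
    V⊆LamOf Body⊆G v∈ with ⌢v-rlam (Values-clique v∈ λt₀∈)
    ... | t , refl = rlam∈ (Body⊆G v∈)

    Body-saturated : Saturated Body
    Body-saturated s s⌢s s⌢B = _ , λs∈ , here refl
      where
      λs∈ : E (bag (rlam x s ∷ []))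
      λs∈ = bag∈ (LamOf-clique (insert-clique Body-clique s⌢s s⌢B))
                 (V⊆LamOf inj₁) (rlam∈ (inj₂ refl) ∷ [])

    Body-height : ∀ {n} → (∀ s → E s → hs s ≤ suc n) → ∀ t → Body t → hs t ≤ n
    Body-height bound t (ws , p , λt∈) =
      ≤-trans (n≤1+n (hs t)) (≤-trans (hv≤hl λt∈) (s≤s⁻¹ (bound _ p)))

    ≐-lam : ∀ {N} → Body ≐ T N → E ≐ T (lam x N)
    ≐-lam {N} B≐N s = to , from
      where
      to : E s → T (lam x N) s
      to s∈ with shape s∈
      ... | ws , refl with All-LamOf⇒map (All.map (V⊆LamOf (proj₁ (B≐N _))) (values s∈))
      ... | ts , Tts , eq = ts , Tts , cong bag eq
      from : T (lam x N) s → E s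
      from (ts , Tts , refl) =
        bag∈ (LamOf-clique Body-clique) (V⊆LamOf (λ b → b))
             (All-LamOf-map (All.map (proj₂ (B≐N _)) Tts))

    lam-case : ∀ {n} → TaylorBelow n → (∀ s → E s → hs s ≤ suc n) → Σ Λ λ M → E ≐ T M
    lam-case IH bound with IH Body-clique Body-saturated Body-nonempty (Body-height bound)
    ... | N , B≐N = lam x N , ≐-lam B≐N

  bag-case : ExcludedMiddle 0ℓ → ∀ {n} → TaylorBelow n → (∀ s → E s → hs s ≤ suc n) →
             Σ Λ λ M → E ≐ T M
  bag-case lem IH bound with lem {Σ RValue Values}
  ... | no none               = ⊥-elim (Values-nonempty none)
  ... | yes (rvar x , x∈)     = var x , ≐-var x∈
  ... | yes (rlam x t , λt∈) = Abstractions.lam-case λt∈ IH bound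

saturatedClique⇒Taylor : ExcludedMiddle 0ℓ → ∀ n → TaylorBelow n
saturatedClique⇒Taylor lem zero _ _ (s , s∈) bound = ⊥-elim (hs≰0 s (bound s s∈))
saturatedClique⇒Taylor lem (suc n) cl sat (sapp a b , ab∈) =
  Applications.app-case cl sat ab∈ (saturatedClique⇒Taylor lem n)
saturatedClique⇒Taylor lem (suc n) cl sat (bag vs , vs∈) =
  Bags.bag-case cl sat vs∈ lem (saturatedClique⇒Taylor lem n)

proposition3p18 : ExcludedMiddle 0ℓ → (E : SSet) →
    (IsMaximalClique (embed E) × HasFiniteHeight E) ⇔ (Σ Λ λ M → E ≐ T M)
proposition3p18 lem E = mk⇔ to from
  where
  to : IsMaximalClique (embed E) × HasFiniteHeight E → Σ Λ λ M → E ≐ T M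
  to (max , n , (s , s∈ , _) , bound) =
    saturatedClique⇒Taylor lem n (maximalClique⇒simpleClique max)
                           (maximalClique⇒saturated max) (s , s∈) bound
  from : (Σ Λ λ M → E ≐ T M) → IsMaximalClique (embed E) × HasFiniteHeight E
  from (M , E≐TM) = maximalClique-resp-≐ E≐TM (T-maximalClique M) ,
                    finiteHeight-resp-≐ E≐TM (T-finiteHeight M)
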